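{- If $G$ is a $2$-connected plane graph with exactly three faces and maximum face degree $\Delta^*(G)$, then $\chi_c(G) \leq \lfloor \frac{3}{2}\Delta^*(G)\rfloor$.
   Context: Plane graphs may have multiple edges but no loops. The degree of a face is the number of vertices incident with it; $\Delta^*(G)$ is the maximum face degree. A cyclic coloring of a plane graph is a vertex coloring in which any two distinct vertices incident with a common face receive distinct colors; $\chi_c(G)$, the cyclic chromatic number, is the minimum number of colors in a cyclic coloring of $G$. -}

module Defs where

open import Data.Nat using (ℕ; zero; suc; _+_; _*_; _≤_; _⊔_)
open import Data.Fin using (Fin)
open import Data.Fin.Properties using (_≟_)
open import Data.List using (List; length; filter; map; foldr)
open import Data.Product using (Σ; ∃; _×_; _,_)
open import Data.List.Base using (allFin)
open import Relation.Binary.PropositionalEquality using (_≡_; _≢_)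
open import Relation.Nullary using (¬_; Dec)
open import Relation.Nullary.Decidable using (_×-dec_)
open import Function.Definitions using (Injective; Surjective)

iter : ∀ {A : Set} → (A → A) → ℕ → A → A
iter p zero    x = x
iter p (suc i) x = p (iter p i x)

SameOrbit : ∀ {A : Set} → (A → A) → A → A → Set
SameOrbit p x y = ∃ λ i → iter p i x ≡ y

data Reach {A : Set} (σ α : A → A) : A → A → Set where
  here  : ∀ {x} → Reach σ α x x
  stepσ : ∀ {x y} → Reach σ α (σ x) y → Reach σ α x y
  stepα : ∀ {x y} → Reach σ α (α x) y → Reach σ α x y

-- A connected plane (multi)graph without loops, given as a combinatorial map
-- (rotation system) of genus 0, with n vertices, m edges and f faces.
-- Darts: Fin (2 * m); α pairs the two darts of each edge; σ is the rotation
-- at vertices; faces are the orbits of σ ∘ α.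
record PlaneGraph (n m f : ℕ) : Set where
  field
    α        : Fin (2 * m) → Fin (2 * m)
    σ        : Fin (2 * m) → Fin (2 * m)
    α-invol  : ∀ x → α (α x) ≡ x
    α-nofix  : ∀ x → α x ≢ x
    σ-perm   : Injective _≡_ _≡_ σ
    vert     : Fin (2 * m) → Fin n
    vert-surj : ∀ v → ∃ λ x → vert x ≡ v
    vert-orb : ∀ x y → vert x ≡ vert y → SameOrbit σ x y
    orb-vert : ∀ x y → SameOrbit σ x y → vert x ≡ vert y
    face     : Fin (2 * m) → Fin f
    face-surj : ∀ F → ∃ λ x → face x ≡ F
    face-orb : ∀ x y → face x ≡ face y → SameOrbit (λ z → σ (α z)) x y
    orb-face : ∀ x y → SameOrbit (λ z → σ (α z)) x y → face x ≡ face y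
    connected : ∀ x y → Reach σ α x y
    euler    : n + f ≡ m + 2                -- genus 0 (plane embedding)
    loopless : ∀ x → vert (α x) ≢ vert x

module _ {n m f : ℕ} (G : PlaneGraph n m f) where
  open PlaneGraph G

  Adj : Fin n → Fin n → Set
  Adj u v = ∃ λ x → vert x ≡ u × vert (α x) ≡ v

  data WalkAvoiding (w : Fin n) : Fin n → Fin n → Set where
    stop : ∀ {u} → WalkAvoiding w u u
    step : ∀ {u u' v} → Adj u u' → u' ≢ w → WalkAvoiding w u' v → WalkAvoiding w u v

  TwoConnected : Set
  TwoConnected = 2 ≤ n × (∀ w u v → u ≢ w → v ≢ w → WalkAvoiding w u v)

  Incident : Fin n → Fin f → Set
  Incident v F = ∃ λ x → vert x ≡ v × face x ≡ F

  incident? : ∀ v F → Dec (Incident v F)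
  incident? v F = Data.Fin.Properties.any? (λ x → (vert x ≟ v) ×-dec (face x ≟ F))
    where import Data.Fin.Properties

  faceDeg : Fin f → ℕ
  faceDeg F = length (filter (λ v → incident? v F) (allFin n))

  maxFaceDeg : ℕ
  maxFaceDeg = foldr _⊔_ 0 (map faceDeg (allFin f))

  Cyclic : ∀ {c} → (Fin n → Fin c) → Set
  Cyclic col = ∀ u v F → u ≢ v → Incident u F → Incident v F → col u ≢ col v

-- Every vertex of a 2-connected plane graph lies on two distinct faces: at a dart x the
-- faces of x and of σ x are the faces on the two sides of the edge of x.  With three faces
-- the face degrees therefore sum to at least 2n, so n ≤ ⌊3Δ*/2⌋ and colouring all vertices
-- differently is a cyclic colouring.
--
-- That an edge e separates two faces is proved by counting the faces of spanning submaps.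
-- A spanning tree avoiding e (which exists since e is no bridge) has a single face, and
-- each further edge adds at most one; so G − e, with m − 1 edges, has at most
-- m − n + 1 = f − 1 faces by Euler's formula.  If both sides of e lay on one face of G,
-- every face of G − e would lie inside a face of G, and G − e would have at least f faces.

module Submission where

open import Defs
open import Data.Bool using (Bool; true; false; _∨_; if_then_else_)
open import Data.Bool.Properties using () renaming (_≟_ to _≟ᵇ_)
open import Data.Empty using (⊥; ⊥-elim)
open import Data.Fin using (Fin; zero; suc; toℕ; inject≤)
open import Data.Fin.Properties using (_≟_; any?; pigeonhole; inject≤-injective; <⇒≢)
open import Data.List using (List; []; _∷_; length; lookup; filter; tabulate; foldr)
open import Data.List.Membership.Propositional using (_∈_)
open import Data.List.Membership.Propositional.Properties using (∈-map⁺; ∈-allFin)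
open import Data.List.Relation.Unary.Any using (here; there; index)
open import Data.List.Relation.Unary.Any.Properties using (lookup-index)
open import Data.Nat using (ℕ; zero; suc; _+_; _*_; _∸_; _/_; _⊔_; _≤_; _<_; _≤?_; z≤n; s≤s)
open import Data.Nat.DivMod using (m*n/n≡m; /-monoˡ-≤)
open import Data.Nat.Induction using (<-wellFounded)
open import Data.Nat.Properties
  using ( ≤-refl; ≤-reflexive; ≤-trans; n≤1+n; n<1+n; m≤n⇒m≤1+n; ≰⇒>; <⇒≱; m≤n⇒∃[o]m+o≡n
        ; +-comm; +-suc; *-suc; +-mono-≤; +-monoʳ-≤; *-monoʳ-≤
        ; +-cancelʳ-≡; +-cancelʳ-≤; *-cancelʳ-≤; ∸-monoʳ-<; m≤m⊔n; m≤n⊔m; module ≤-Reasoning )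
open import Data.Nat.Tactic.RingSolver using (solve-∀)
open import Data.Product using (∃; _×_; _,_; proj₁; proj₂)
open import Data.Sum using (_⊎_; inj₁; inj₂)
open import Function using (_∘_)
open import Function.Definitions using (Injective)
open import Induction.WellFounded using (WellFounded; Acc; acc; module Subrelation)
open import Relation.Binary.Construct.On as On using ()
open import Relation.Binary.PropositionalEquality
  using (_≡_; _≢_; refl; sym; trans; cong; subst; subst₂; module ≡-Reasoning)
open import Relation.Nullary using (¬_; Dec; yes; no; does)
open import Relation.Nullary.Decidable using (_⊎-dec_; _×-dec_; ¬?; dec-true; ¬¬-excluded-middle)
open import Relation.Nullary.Negation using (¬¬-map)
open import Relation.Unary using (Decidable)

private
  variable
    A : Set
    k : ℕ

iter-+ : (f : A → A) (i j : ℕ) (x : A) → iter f (i + j) x ≡ iter f i (iter f j x)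
iter-+ f zero    j x = refl
iter-+ f (suc i) j x = cong f (iter-+ f i j x)

iter-injective : {f : A → A} → Injective _≡_ _≡_ f → ∀ i {x y} → iter f i x ≡ iter f i y → x ≡ y
iter-injective f-inj zero    eq = eq
iter-injective f-inj (suc i) eq = iter-injective f-inj i (f-inj eq)

iter-periodic : (f : A → A) {x : A} (p : ℕ) → iter f (suc p) x ≡ x → ∀ i → iter f (i * suc p) x ≡ x
iter-periodic f p per zero    = refl
iter-periodic f {x} p per (suc i) = begin
  iter f (suc p + i * suc p) x        ≡⟨ iter-+ f (suc p) (i * suc p) x ⟩
  iter f (suc p) (iter f (i * suc p) x) ≡⟨ cong (iter f (suc p)) (iter-periodic f p per i) ⟩
  iter f (suc p) x                    ≡⟨ per ⟩
  x                                   ∎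
  where open ≡-Reasoning

-- Two of the k + 1 points x, f x, …, fᵏ x coincide; injectivity cancels the smaller exponent.
injective⇒periodic : {f : Fin k → Fin k} → Injective _≡_ _≡_ f →
                     ∀ x → ∃ λ p → iter f (suc p) x ≡ x
injective⇒periodic {k} {f} f-inj x with pigeonhole (n<1+n k) (λ i → iter f (toℕ i) x)
... | i , j , i<j , eq with m≤n⇒∃[o]m+o≡n i<j
... | d , i+1+d≡j = d , sym (iter-injective f-inj (toℕ i) (begin
  iter f (toℕ i) x                  ≡⟨ eq ⟩
  iter f (toℕ j) x                  ≡⟨ cong (λ t → iter f t x) (sym (trans (+-suc _ d) i+1+d≡j)) ⟩
  iter f (toℕ i + suc d) x          ≡⟨ iter-+ f (toℕ i) (suc d) x ⟩
  iter f (toℕ i) (iter f (suc d) x) ∎))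
  where open ≡-Reasoning

module _ {f : A → A} where

  orbit-refl : ∀ {x} → SameOrbit f x x
  orbit-refl = 0 , refl

  orbit-next : ∀ {x} → SameOrbit f x (f x)
  orbit-next = 1 , refl

  orbit-snoc : ∀ {x y} → SameOrbit f x y → SameOrbit f x (f y)
  orbit-snoc (i , eq) = suc i , cong f eq

  orbit-trans : ∀ {x y z} → SameOrbit f x y → SameOrbit f y z → SameOrbit f x z
  orbit-trans {x} (i , refl) (j , refl) = j + i , iter-+ f j i x

  orbit-induction : (Q : A → Set) → (∀ {z} → Q z → Q (f z)) →
                    ∀ {x y} → Q x → SameOrbit f x y → Q y
  orbit-induction Q next Qx (zero  , refl) = Qx
  orbit-induction Q next Qx (suc i , refl) = next (orbit-induction Q next Qx (i , refl))

  orbit-invariant : {B : Set} (g : A → B) → (∀ z → g (f z) ≡ g z) →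
                    ∀ {x y} → SameOrbit f x y → g x ≡ g y
  orbit-invariant g inv {x} = orbit-induction (λ y → g x ≡ g y) (λ {z} eq → trans eq (sym (inv z))) refl

orbit-sym : {f : Fin k → Fin k} → Injective _≡_ _≡_ f → ∀ {x y} → SameOrbit f x y → SameOrbit f y x
orbit-sym {f = f} f-inj {x} (i , refl) with injective⇒periodic f-inj x
... | p , per = i * p , (begin
  iter f (i * p) (iter f i x) ≡⟨ sym (iter-+ f (i * p) i x) ⟩
  iter f (i * p + i) x        ≡⟨ cong (λ t → iter f t x) (trans (+-comm (i * p) i) (sym (*-suc i p))) ⟩
  iter f (i * suc p) x        ≡⟨ iter-periodic f p per i ⟩
  x                           ∎)
  where open ≡-Reasoning

bit : Bool → ℕ
bit b = if b then 1 else 0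

count : (Fin k → Bool) → ℕ
count {zero}  P = 0
count {suc k} P = bit (P zero) + count (P ∘ suc)

∅ : Fin k → Bool
∅ _ = false

insert : (Fin k → Bool) → Fin k → Fin k → Bool
insert P a z = does (z ≟ a) ∨ P z

module _ (P : Fin k → Bool) where

  insert-here : ∀ a → insert P a a ≡ true
  insert-here a with a ≟ a
  ... | yes _  = refl
  ... | no a≢a = ⊥-elim (a≢a refl)

  insert-old : ∀ a {z} → P z ≡ true → insert P a z ≡ true
  insert-old a {z} Pz with z ≟ a
  ... | yes _ = refl
  ... | no  _ = Pz

  insert-≢ : ∀ {a z} → z ≢ a → insert P a z ≡ P z
  insert-≢ {a} {z} z≢a with z ≟ a
  ... | yes z≡a = ⊥-elim (z≢a z≡a)
  ... | no  _   = refl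

  insert-inv : ∀ a z → insert P a z ≡ true → z ≡ a ⊎ P z ≡ true
  insert-inv a z eq with z ≟ a
  ... | yes z≡a = inj₁ z≡a
  ... | no  _   = inj₂ eq

count-≤ : (P : Fin k → Bool) → count P ≤ k
count-≤ {zero}  P = z≤n
count-≤ {suc k} P with P zero
... | true  = s≤s (count-≤ (P ∘ suc))
... | false = m≤n⇒m≤1+n (count-≤ (P ∘ suc))

count-full : (P : Fin k → Bool) → (∀ z → P z ≡ true) → count P ≡ k
count-full {zero}  P full = refl
count-full {suc k} P full rewrite full zero = cong suc (count-full (P ∘ suc) (full ∘ suc))

count-∅ : count (∅ {k}) ≡ 0
count-∅ {zero}  = refl
count-∅ {suc k} = count-∅ {k}

count-insert : (P : Fin k → Bool) (a : Fin k) → P a ≡ false → count (insert P a) ≡ suc (count P)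
count-insert P zero    Pa rewrite Pa = refl
count-insert P (suc a) Pa with P zero
... | true  = cong suc (count-insert (P ∘ suc) a Pa)
... | false = count-insert (P ∘ suc) a Pa

count-mono : {P Q : Fin k → Bool} → (∀ z → P z ≡ true → Q z ≡ true) → count P ≤ count Q
count-mono {zero}          P⊆Q = z≤n
count-mono {suc k} {P} {Q} P⊆Q = +-mono-≤ (bit-mono (P⊆Q zero)) (count-mono (P⊆Q ∘ suc))
  where
  bit-mono : ∀ {b c} → (b ≡ true → c ≡ true) → bit b ≤ bit c
  bit-mono {false}         _   = z≤n
  bit-mono {true}  {true}  _   = ≤-refl
  bit-mono {true}  {false} b⇒c with b⇒c refl
  ... | ()

count-≥2 : {P : Fin k → Bool} {a b : Fin k} → a ≢ b → P a ≡ true → P b ≡ true → 2 ≤ count P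
count-≥2 {k} {P} {a} {b} a≢b Pa Pb = begin
  2                               ≡⟨ cong (2 +_) (sym (count-∅ {k})) ⟩
  2 + count (∅ {k})               ≡⟨ cong suc (sym (count-insert ∅ a refl)) ⟩
  suc (count (insert ∅ a))        ≡⟨ sym (count-insert _ b (insert-≢ ∅ (a≢b ∘ sym))) ⟩
  count (insert (insert ∅ a) b)   ≤⟨ count-mono ⊆P ⟩
  count P                         ∎
  where
  open ≤-Reasoning
  ⊆P : ∀ z → insert (insert ∅ a) b z ≡ true → P z ≡ true
  ⊆P z eq with insert-inv (insert ∅ a) b z eq
  ... | inj₁ refl = Pb
  ... | inj₂ eq′ with insert-inv ∅ a z eq′
  ...   | inj₁ refl = Pa
  ...   | inj₂ ()

count-three-rows : (M : Fin 3 → Fin k → Bool) → (∀ z → 2 ≤ count (λ i → M i z)) →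
                   k * 2 ≤ count (M zero) + count (M (suc zero)) + count (M (suc (suc zero)))
count-three-rows {zero}  M columns = z≤n
count-three-rows {suc k} M columns = subst (suc k * 2 ≤_) (regroup (bit (M zero zero)) _ _ _ _ _)
  (+-mono-≤ (columns zero) (count-three-rows (λ i → M i ∘ suc) (columns ∘ suc)))
  where
  regroup : ∀ a b c x y z → a + (b + (c + 0)) + (x + y + z) ≡ a + x + (b + y) + (c + z)
  regroup = solve-∀

LargerThan : (Fin k → Bool) → (Fin k → Bool) → Set
LargerThan Q P = count P < count Q

LargerThan-wellFounded : WellFounded (LargerThan {k})
LargerThan-wellFounded {k} = Subrelation.wellFounded (λ {Q} P<Q → ∸-monoʳ-< P<Q (count-≤ Q))
                               (On.wellFounded (λ P → k ∸ count P) <-wellFounded)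

onto⇒≤-length : {g : A → Fin k} (L : List A) →
                (∀ i → ∃ λ x → x ∈ L × g x ≡ i) → k ≤ length L
onto⇒≤-length {k = k} {g} L onto with k ≤? length L
... | yes k≤L = k≤L
... | no  k≰L with pigeonhole (≰⇒> k≰L) (index ∘ proj₁ ∘ proj₂ ∘ onto)
...   | i , j , i<j , same-index = ⊥-elim (<⇒≢ i<j (begin
  i                                 ≡⟨ sym (hit i) ⟩
  g (lookup L (index (member i)))   ≡⟨ cong (g ∘ lookup L) same-index ⟩
  g (lookup L (index (member j)))   ≡⟨ hit j ⟩
  j                                 ∎))
  where
  open ≡-Reasoning
  member : ∀ i → proj₁ (onto i) ∈ L
  member i = proj₁ (proj₂ (onto i))
  hit : ∀ i → g (lookup L (index (member i))) ≡ i
  hit i = trans (cong g (sym (lookup-index (member i)))) (proj₂ (proj₂ (onto i)))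

length-filter-tabulate : {P : A → Set} (P? : Decidable P) (g : Fin k → A) →
                         length (filter P? (tabulate g)) ≡ count (λ i → does (P? (g i)))
length-filter-tabulate {k = zero}  P? g = refl
length-filter-tabulate {k = suc k} P? g with does (P? (g zero))
... | true  = cong suc (length-filter-tabulate P? (g ∘ suc))
... | false = length-filter-tabulate P? (g ∘ suc)

≤-foldr-⊔ : ∀ {x xs} → x ∈ xs → x ≤ foldr _⊔_ 0 xs
≤-foldr-⊔ (here refl)  = m≤m⊔n _ _
≤-foldr-⊔ (there x∈xs) = ≤-trans (≤-foldr-⊔ x∈xs) (m≤n⊔m _ _)

-- Faces of spanning submaps

module _ {n m f : ℕ} (G : PlaneGraph n m f) where
  open PlaneGraph G

  Dart : Set
  Dart = Fin (2 * m)

  α-injective : Injective _≡_ _≡_ α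
  α-injective {x} {y} eq = trans (sym (α-invol x)) (trans (cong α eq) (α-invol y))

  vert-σ : ∀ x → vert (σ x) ≡ vert x
  vert-σ x = sym (orb-vert x (σ x) orbit-next)

  face-σα : ∀ x → face (σ (α x)) ≡ face x
  face-σα x = sym (orb-face x (σ (α x)) orbit-next)

  face-σ : ∀ x → face (σ x) ≡ face (α x)
  face-σ x = sym (orb-face (α x) (σ x) (1 , cong σ (α-invol x)))

  -- An α-closed set T of darts is a set of edges.  In the spanning submap with edge set T
  -- every other edge is cut into two half-edges fixed by the involution, so its faces are
  -- the orbits of φ T.
  Closed : (Dart → Bool) → Set
  Closed T = ∀ x → T (α x) ≡ T x

  α∣ : (Dart → Bool) → Dart → Dart
  α∣ T x = if T x then α x else x

  φ : (Dart → Bool) → Dart → Dart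
  φ T x = σ (α∣ T x)

  α∣-involutive : ∀ {T} → Closed T → ∀ x → α∣ T (α∣ T x) ≡ x
  α∣-involutive {T} closed x with T x in Tx
  ... | true  rewrite closed x | Tx = α-invol x
  ... | false rewrite Tx = refl

  φ-injective : ∀ {T} → Closed T → Injective _≡_ _≡_ (φ T)
  φ-injective {T} closed {x} {y} eq =
    trans (sym (α∣-involutive closed x)) (trans (cong (α∣ T) (σ-perm eq)) (α∣-involutive closed y))

  α∣-∈ : ∀ T {x} → T x ≡ true → α∣ T x ≡ α x
  α∣-∈ T Tx rewrite Tx = refl

  α∣-∉ : ∀ T {x} → T x ≡ false → α∣ T x ≡ x
  α∣-∉ T Tx rewrite Tx = refl

  OnEdge : Dart → Dart → Set
  OnEdge a s = s ≡ a ⊎ s ≡ α a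

  onEdge? : ∀ a z → Dec (OnEdge a z)
  onEdge? a z = (z ≟ a) ⊎-dec (z ≟ α a)

  onEdge-sym : ∀ {a s} → OnEdge a s → OnEdge s a
  onEdge-sym     (inj₁ refl) = inj₁ refl
  onEdge-sym {a} (inj₂ refl) = inj₂ (sym (α-invol a))

  addEdge : (Dart → Bool) → Dart → Dart → Bool
  addEdge T a = insert (insert T a) (α a)

  module _ (T : Dart → Bool) (a : Dart) where

    addEdge-a : addEdge T a a ≡ true
    addEdge-a = insert-old (insert T a) (α a) (insert-here T a)

    addEdge-αa : addEdge T a (α a) ≡ true
    addEdge-αa = insert-here (insert T a) (α a)

    addEdge-old : ∀ {z} → T z ≡ true → addEdge T a z ≡ true
    addEdge-old Tz = insert-old (insert T a) (α a) (insert-old T a Tz)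

    addEdge-other : ∀ {z} → ¬ OnEdge a z → addEdge T a z ≡ T z
    addEdge-other z∉a = trans (insert-≢ (insert T a) (z∉a ∘ inj₂)) (insert-≢ T (z∉a ∘ inj₁))

    addEdge-inv : ∀ z → addEdge T a z ≡ true → OnEdge a z ⊎ T z ≡ true
    addEdge-inv z eq with insert-inv (insert T a) (α a) z eq
    ... | inj₁ z≡αa = inj₁ (inj₂ z≡αa)
    ... | inj₂ eq′ with insert-inv T a z eq′
    ...   | inj₁ z≡a = inj₁ (inj₁ z≡a)
    ...   | inj₂ Tz  = inj₂ Tz

    addEdge-closed : Closed T → Closed (addEdge T a)
    addEdge-closed closed z with onEdge? a z
    ... | yes (inj₁ refl) = trans addEdge-αa (sym addEdge-a)
    ... | yes (inj₂ refl) = trans (cong (addEdge T a) (α-invol a)) (trans addEdge-a (sym addEdge-αa))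
    ... | no z∉a          = trans (addEdge-other αz∉a) (trans (closed z) (sym (addEdge-other z∉a)))
      where
      αz∉a : ¬ OnEdge a (α z)
      αz∉a (inj₁ αz≡a)  = z∉a (inj₂ (trans (sym (α-invol z)) (cong α αz≡a)))
      αz∉a (inj₂ αz≡αa) = z∉a (inj₁ (α-injective αz≡αa))

    count-addEdge : Closed T → T a ≡ false → count (addEdge T a) ≡ 2 + count T
    count-addEdge closed a∉T = begin
      count (insert (insert T a) (α a)) ≡⟨ count-insert _ (α a) αa∉T⁺ ⟩
      suc (count (insert T a))          ≡⟨ cong suc (count-insert T a a∉T) ⟩
      2 + count T                       ∎
      where
      open ≡-Reasoning
      αa∉T⁺ : insert T a (α a) ≡ false
      αa∉T⁺ = trans (insert-≢ T (α-nofix a)) (trans (closed a) a∉T)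

    addEdge-larger : Closed T → T a ≡ false → LargerThan (addEdge T a) T
    addEdge-larger closed a∉T = subst (count T <_) (sym (count-addEdge closed a∉T)) (n≤1+n (suc (count T)))

  -- L contains a dart of every face of the submap T, so length L bounds their number.
  HasRep : (Dart → Bool) → List Dart → Dart → Set
  HasRep T L z = ∃ λ l → l ∈ L × SameOrbit (φ T) l z

  Represented : (Dart → Bool) → List Dart → Set
  Represented T L = ∀ z → HasRep T L z

  OrbitCovers : (Dart → Bool) → Dart → (Fin n → Bool) → Set
  OrbitCovers T l S = ∀ z → S (vert z) ≡ true → SameOrbit (φ T) l z

  module AddEdge (T : Dart → Bool) (closed : Closed T) (a : Dart) (a∉T : T a ≡ false) where

    T⁺ : Dart → Bool
    T⁺ = addEdge T a

    φ⁺ : Dart → Dart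
    φ⁺ = φ T⁺

    φ⁺-a : φ⁺ a ≡ φ T (α a)
    φ⁺-a = cong σ (trans (α∣-∈ T⁺ (addEdge-a T a)) (sym (α∣-∉ T (trans (closed a) a∉T))))

    φ⁺-αa : φ⁺ (α a) ≡ φ T a
    φ⁺-αa = cong σ (trans (α∣-∈ T⁺ (addEdge-αa T a)) (trans (α-invol a) (sym (α∣-∉ T a∉T))))

    φ⁺-other : ∀ {z} → ¬ OnEdge a z → φ⁺ z ≡ φ T z
    φ⁺-other {z} z∉a = cong (λ b → σ (if b then α z else z)) (addEdge-other T a z∉a)

    -- A φ T-path from r to u either survives in φ⁺ or passes through the new edge.
    data Detour (r u : Dart) : Set where
      direct : SameOrbit φ⁺ r u → Detour r u
      via    : ∀ {s t} → OnEdge a s → OnEdge a t → SameOrbit φ⁺ r s → SameOrbit φ⁺ t u → Detour r u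

    detour-entry : ∀ {r u} → Detour r u → OnEdge a u → ∃ λ s → OnEdge a s × SameOrbit φ⁺ r s
    detour-entry (direct r⇝u)           u∈a = _ , u∈a , r⇝u
    detour-entry (via s∈a _ r⇝s _)      _   = _ , s∈a , r⇝s

    detour-snoc : ∀ {r u} → Detour r u → Detour r (φ⁺ u)
    detour-snoc (direct r⇝u)            = direct (orbit-snoc r⇝u)
    detour-snoc (via s∈a t∈a r⇝s t⇝u)   = via s∈a t∈a r⇝s (orbit-snoc t⇝u)

    detour-step : ∀ {r u} → Detour r u → Detour r (φ T u)
    detour-step {u = u} d with onEdge? a u
    ... | yes (inj₁ refl) with detour-entry d (inj₁ refl)
    ...   | _ , s∈a , r⇝s = via s∈a (inj₂ refl) r⇝s (subst (SameOrbit φ⁺ (α a)) φ⁺-αa orbit-next)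
    detour-step d | yes (inj₂ refl) with detour-entry d (inj₂ refl)
    ...   | _ , s∈a , r⇝s = via s∈a (inj₁ refl) r⇝s (subst (SameOrbit φ⁺ a) φ⁺-a orbit-next)
    detour-step d | no u∉a = subst (Detour _) (φ⁺-other u∉a) (detour-snoc d)

    orbit⇒detour : ∀ {r u} → SameOrbit (φ T) r u → Detour r u
    orbit⇒detour (zero  , refl) = direct orbit-refl
    orbit⇒detour (suc i , refl) = detour-step (orbit⇒detour (i , refl))

    -- Double negation lets the proof split on whether L reaches a in φ⁺ without deciding it.
    represented-addEdge : ∀ {L} → Represented T L →
                          ¬ ¬ (∃ λ L⁺ → length L⁺ ≡ suc (length L) × Represented T⁺ L⁺)
    represented-addEdge {L} rep = ¬¬-map extend ¬¬-excluded-middle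
      where
      extend : Dec (HasRep T⁺ L a) → ∃ λ L⁺ → length L⁺ ≡ suc (length L) × Represented T⁺ L⁺
      extend (yes (la , la∈L , la⇝a)) = α a ∷ L , refl , reach ∘ rep
        where
        reach : ∀ {z} → HasRep T L z → HasRep T⁺ (α a ∷ L) z
        reach (l , l∈L , l⇝z) with orbit⇒detour l⇝z
        ... | direct l⇝z′                  = l , there l∈L , l⇝z′
        ... | via _ (inj₁ refl) _ a⇝z      = la , there la∈L , orbit-trans la⇝a a⇝z
        ... | via _ (inj₂ refl) _ αa⇝z     = α a , here refl , αa⇝z
      extend (no a-unreached) = a ∷ L , refl , reach ∘ rep
        where
        reach : ∀ {z} → HasRep T L z → HasRep T⁺ (a ∷ L) z
        reach (l , l∈L , l⇝z) with orbit⇒detour l⇝z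
        ... | direct l⇝z′                          = l , there l∈L , l⇝z′
        ... | via _ (inj₁ refl) _ a⇝z              = a , here refl , a⇝z
        ... | via (inj₁ refl) (inj₂ refl) l⇝a _    = ⊥-elim (a-unreached (l , l∈L , l⇝a))
        ... | via (inj₂ refl) (inj₂ refl) l⇝αa αa⇝z = l , there l∈L , orbit-trans l⇝αa αa⇝z

  -- Attaching a leaf w = vert (α a) to a subtree spanning the vertices S merges all
  -- darts at w into the face of the subtree.
  module AttachLeaf (S : Fin n → Bool) (T : Dart → Bool) (closed : Closed T)
                    (T⊆S : ∀ z → T z ≡ true → S (vert z) ≡ true)
                    (a : Dart) (Sa : S (vert a) ≡ true) (w∉S : S (vert (α a)) ≡ false) where

    w : Fin n
    w = vert (α a)

    at-w∉T : ∀ {z} → vert z ≡ w → T z ≡ false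
    at-w∉T {z} z-at-w with T z in Tz
    ... | false = refl
    ... | true with trans (sym (T⊆S z Tz)) (trans (cong S z-at-w) w∉S)
    ...   | ()

    a∉T : T a ≡ false
    a∉T = trans (sym (closed a)) (at-w∉T refl)

    open AddEdge T closed a a∉T public

    S⁺ : Fin n → Bool
    S⁺ = insert S w

    T⁺⊆S⁺ : ∀ z → T⁺ z ≡ true → S⁺ (vert z) ≡ true
    T⁺⊆S⁺ z eq with addEdge-inv T a z eq
    ... | inj₁ (inj₁ refl) = insert-old S w Sa
    ... | inj₁ (inj₂ refl) = insert-here S w
    ... | inj₂ Tz          = insert-old S w (T⊆S z Tz)

    φ⁺-at-w : ∀ {z} → vert z ≡ w → z ≢ α a → φ⁺ z ≡ σ z
    φ⁺-at-w {z} z-at-w z≢αa = cong σ (α∣-∉ T⁺ (trans (addEdge-other T a z∉a) (at-w∉T z-at-w)))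
      where
      z∉a : ¬ OnEdge a z
      z∉a (inj₁ refl) with trans (sym Sa) (trans (cong S z-at-w) w∉S)
      ... | ()
      z∉a (inj₂ z≡αa) = z≢αa z≡αa

    -- The σ-orbit at w is entered from a and then followed by φ⁺ until it returns to α a.
    leaf-orbit : ∀ {u} → vert u ≡ w → SameOrbit φ⁺ a u
    leaf-orbit {u} u-at-w =
      proj₂ (orbit-induction Q next (vert-σ (α a) , subst (SameOrbit φ⁺ a) (φ⁺-a′) orbit-next)
                             (vert-orb (σ (α a)) u (trans (vert-σ (α a)) (sym u-at-w))))
      where
      Q : Dart → Set
      Q z = vert z ≡ w × SameOrbit φ⁺ a z
      φ⁺-a′ : φ⁺ a ≡ σ (α a)
      φ⁺-a′ = cong σ (α∣-∈ T⁺ (addEdge-a T a))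
      next : ∀ {z} → Q z → Q (σ z)
      next {z} (z-at-w , a⇝z) with z ≟ α a
      ... | yes refl = trans (vert-σ z) z-at-w , subst (SameOrbit φ⁺ a) φ⁺-a′ orbit-next
      ... | no z≢αa  = trans (vert-σ z) z-at-w ,
                       subst (SameOrbit φ⁺ a) (φ⁺-at-w z-at-w z≢αa) (orbit-snoc a⇝z)

    detour⇒orbit : ∀ {r u} → Detour r u → SameOrbit φ⁺ r u
    detour⇒orbit (direct r⇝u)          = r⇝u
    detour⇒orbit (via s∈a t∈a r⇝s t⇝u) =
      orbit-trans r⇝s (orbit-trans (to-a s∈a) (orbit-trans (from-a t∈a) t⇝u))
      where
      from-a : ∀ {s} → OnEdge a s → SameOrbit φ⁺ a s
      from-a (inj₁ refl) = orbit-refl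
      from-a (inj₂ refl) = leaf-orbit refl
      to-a : ∀ {s} → OnEdge a s → SameOrbit φ⁺ s a
      to-a s∈a = orbit-sym (φ-injective (addEdge-closed T a closed)) (from-a s∈a)

    attach : ∀ {l} → OrbitCovers T l S → OrbitCovers T⁺ l S⁺
    attach cover z Sz with insert-inv S w (vert z) Sz
    ... | inj₁ z-at-w = orbit-trans (detour⇒orbit (orbit⇒detour (cover a Sa))) (leaf-orbit z-at-w)
    ... | inj₂ Sz′    = detour⇒orbit (orbit⇒detour (cover z Sz′))

  -- Cuts and bridges

  Crossing : (Fin n → Bool) → Dart → Set
  Crossing S a = S (vert a) ≡ true × S (vert (α a)) ≡ false

  crossing? : ∀ S a → Dec (Crossing S a)
  crossing? S a = (S (vert a) ≟ᵇ true) ×-dec (S (vert (α a)) ≟ᵇ false)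

  crossing-on-walk : ∀ (S : Fin n → Bool) {w s t} → WalkAvoiding G w s t →
                     s ≢ w → S s ≡ true → S t ≡ false → ∃ λ a → Crossing S a × vert a ≢ w × vert (α a) ≢ w
  crossing-on-walk S stop _ Ss St with trans (sym Ss) St
  ... | ()
  crossing-on-walk S (step {u' = s′} (a , a-at-s , αa-at-s′) s′≢w walk) s≢w Ss St with S s′ in Ss′
  ... | false = a , (trans (cong S a-at-s) Ss , trans (cong S αa-at-s′) Ss′) ,
                (λ eq → s≢w (trans (sym a-at-s) eq)) , (λ eq → s′≢w (trans (sym αa-at-s′) eq))
  ... | true  = crossing-on-walk S walk s′≢w Ss′ St

  -- In a 2-connected graph with a second edge, the edge of x0 is not a bridge.
  not-a-bridge : TwoConnected G → ∀ x0 {y} → ¬ OnEdge x0 y →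
                 (S : Fin n → Bool) → S (vert x0) ≡ true → (∀ a → Crossing S a → a ≡ x0) → ∀ v → S v ≡ true
  not-a-bridge (_ , avoiding) x0 {y} y∉x0 S Sp cut v with S v in Sv
  ... | true  = refl
  ... | false = ⊥-elim (second-edge-crosses (subst (λ u → S u ≡ false) (outside-is-q v Sv) Sv))
    where
    p q : Fin n
    p = vert x0
    q = vert (α x0)

    p≢q : p ≢ q
    p≢q = loopless x0 ∘ sym

    outside-is-q : ∀ t → S t ≡ false → t ≡ q
    outside-is-q t St with t ≟ q
    ... | yes t≡q = t≡q
    ... | no  t≢q with crossing-on-walk S (avoiding q p t p≢q t≢q) p≢q Sp St
    ...   | a , cr , _ , αa≢q with cut a cr
    ...     | refl = ⊥-elim (αa≢q refl)

    inside-is-p : S q ≡ false → ∀ s → S s ≡ true → s ≡ p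
    inside-is-p Sq s Ss with s ≟ p
    ... | yes s≡p = s≡p
    ... | no  s≢p with crossing-on-walk S (avoiding p s q s≢p (p≢q ∘ sym)) s≢p Ss Sq
    ...   | a , cr , a≢p , _ with cut a cr
    ...     | refl = ⊥-elim (a≢p refl)

    -- Every vertex is p or q, so the second edge y joins p and q and crosses the cut.
    second-edge-crosses : S q ≡ false → ⊥
    second-edge-crosses Sq with S (vert y) in Sy | S (vert (α y)) in Sαy
    ... | true  | false = y∉x0 (inj₁ (cut y (Sy , Sαy)))
    ... | false | true  = y∉x0 (inj₂ (trans (sym (α-invol y)) (cong α (cut (α y) (Sαy , Sαα)))))
      where
      Sαα : S (vert (α (α y))) ≡ false
      Sαα = trans (cong (S ∘ vert) (α-invol y)) Sy
    ... | true  | true  = loopless y (trans (inside-is-p Sq _ Sαy) (sym (inside-is-p Sq _ Sy)))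
    ... | false | false = loopless y (trans (outside-is-q _ Sαy) (sym (outside-is-q _ Sy)))

  second-edge : 2 ≤ m → ∀ x → ∃ λ y → ¬ OnEdge x y
  second-edge m≥2 x with any? (λ y → ¬? (onEdge? x y))
  ... | yes found = found
  ... | no none   = ⊥-elim (4≰2 (subst (4 ≤_) (begin
    2 * m                 ≡⟨ sym (count-full (addEdge ∅ x) on-x) ⟩
    count (addEdge ∅ x)   ≡⟨ count-addEdge ∅ x (λ _ → refl) refl ⟩
    2 + count (∅ {2 * m}) ≡⟨ cong (2 +_) (count-∅ {2 * m}) ⟩
    2                     ∎) (*-monoʳ-≤ 2 m≥2)))
    where
    open ≡-Reasoning
    4≰2 : ¬ 4 ≤ 2
    4≰2 (s≤s (s≤s ()))
    on-x : ∀ z → addEdge ∅ x z ≡ true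
    on-x z with onEdge? x z
    ... | yes (inj₁ refl) = addEdge-a ∅ x
    ... | yes (inj₂ refl) = addEdge-αa ∅ x
    ... | no z∉x          = ⊥-elim (none (z , z∉x))

  -- Every edge separates two faces

  module EdgeOnOneFace (tc : TwoConnected G) (x0 : Dart) {y : Dart} (y∉x0 : ¬ OnEdge x0 y)
                       (same : face x0 ≡ face (α x0)) where

    record GrowingTree (S : Fin n → Bool) (T : Dart → Bool) : Set where
      field
        closed : Closed T
        x0∉T   : T x0 ≡ false
        T⊆S    : ∀ z → T z ≡ true → S (vert z) ≡ true
        root   : S (vert x0) ≡ true
        size   : 2 + count T ≡ count S * 2
        covers : OrbitCovers T x0 S

    record EulerBound (T : Dart → Bool) : Set where
      field
        closed      : Closed T
        x0∉T        : T x0 ≡ false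
        reps        : List Dart
        represented : Represented T reps
        bound       : (length reps + n) * 2 ≤ 4 + count T   -- faces ≤ edges − n + 2

    x0∉addEdge : ∀ T a → ¬ OnEdge x0 a → T x0 ≡ false → addEdge T a x0 ≡ false
    x0∉addEdge T a a∉x0 x0∉T = trans (addEdge-other T a (a∉x0 ∘ onEdge-sym)) x0∉T

    grow-tree : ∀ S T → Acc LargerThan T → GrowingTree S T → ∃ EulerBound
    grow-tree S T (acc larger) tree with any? (λ a → crossing? S a ×-dec ¬? (a ≟ x0))
    ... | yes (a , (Sa , w∉S) , a≢x0) = grow-tree S⁺ T⁺ (larger (addEdge-larger T a closed a∉T)) record
      { closed = addEdge-closed T a closed
      ; x0∉T   = x0∉addEdge T a a∉x0 x0∉T
      ; T⊆S    = T⁺⊆S⁺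
      ; root   = insert-old S w root
      ; size   = trans (cong (2 +_) (count-addEdge T a closed a∉T))
                       (trans (cong (2 +_) size) (cong (_* 2) (sym (count-insert S w w∉S))))
      ; covers = attach covers
      }
      where
      open GrowingTree tree
      open AttachLeaf S T closed T⊆S a Sa w∉S
      a∉x0 : ¬ OnEdge x0 a
      a∉x0 (inj₁ a≡x0)  = a≢x0 a≡x0
      a∉x0 (inj₂ refl) with trans (sym root) (trans (cong (S ∘ vert) (sym (α-invol x0))) w∉S)
      ... | ()
    ... | no no-crossing = T , record
      { closed      = closed
      ; x0∉T        = x0∉T
      ; reps        = x0 ∷ []
      ; represented = λ z → x0 , here refl , covers z (spanning (vert z))
      ; bound       = ≤-reflexive (cong (2 +_) (sym (trans size (cong (_* 2) (count-full S spanning)))))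
      }
      where
      open GrowingTree tree
      cut : ∀ a → Crossing S a → a ≡ x0
      cut a cr with a ≟ x0
      ... | yes a≡x0 = a≡x0
      ... | no  a≢x0 = ⊥-elim (no-crossing (a , cr , a≢x0))
      spanning : ∀ v → S v ≡ true
      spanning = not-a-bridge tc x0 y∉x0 S root cut

    saturated : ∀ T → EulerBound T → (∀ z → ¬ OnEdge x0 z → T z ≡ true) → ⊥
    saturated T eb full = <⇒≱ reps<f f≤reps
      where
      open EulerBound eb

      face-φ : ∀ z → face (φ T z) ≡ face z
      face-φ z with onEdge? x0 z
      ... | yes (inj₁ refl) = trans (cong (face ∘ σ) (α∣-∉ T x0∉T)) (trans (face-σ x0) (sym same))
      ... | yes (inj₂ refl) = trans (cong (face ∘ σ) (α∣-∉ T αx0∉T)) (trans (face-σα x0) same)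
        where
        αx0∉T : T (α x0) ≡ false
        αx0∉T = trans (closed x0) x0∉T
      ... | no  z∉x0        = trans (cong (face ∘ σ) (α∣-∈ T (full z z∉x0))) (face-σα z)

      f≤reps : f ≤ length reps
      f≤reps = onto⇒≤-length reps face-of-rep
        where
        face-of-rep : ∀ F → ∃ λ l → l ∈ reps × face l ≡ F
        face-of-rep F with face-surj F
        ... | d , d-on-F with represented d
        ...   | l , l∈reps , l⇝d = l , l∈reps , trans (orbit-invariant face face-φ l⇝d) d-on-F

      all-but-x0 : 2 + count T ≡ 2 * m
      all-but-x0 = trans (sym (count-addEdge T x0 closed x0∉T)) (count-full (addEdge T x0) everything)
        where
        everything : ∀ z → addEdge T x0 z ≡ true
        everything z with onEdge? x0 z
        ... | yes (inj₁ refl) = addEdge-a T x0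
        ... | yes (inj₂ refl) = addEdge-αa T x0
        ... | no  z∉x0        = addEdge-old T x0 (full z z∉x0)

      reps<f : length reps < f
      reps<f = +-cancelʳ-≤ n _ _ (*-cancelʳ-≤ _ _ 2 (begin
        2 + (length reps + n) * 2 ≤⟨ +-monoʳ-≤ 2 bound ⟩
        4 + (2 + count T)         ≡⟨ cong (4 +_) all-but-x0 ⟩
        4 + 2 * m                 ≡⟨ regroup m ⟩
        (m + 2) * 2               ≡⟨ cong (_* 2) (trans (sym euler) (+-comm n f)) ⟩
        (f + n) * 2               ∎))
        where
        open ≤-Reasoning
        regroup : ∀ k → 4 + 2 * k ≡ (k + 2) * 2
        regroup = solve-∀

    fill : ∀ T → Acc LargerThan T → EulerBound T → ⊥
    fill T (acc larger) eb with any? (λ a → (T a ≟ᵇ false) ×-dec ¬? (onEdge? x0 a))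
    ... | yes (a , a∉T , a∉x0) = represented-addEdge represented continue
      where
      open EulerBound eb
      open AddEdge T closed a a∉T
      continue : (∃ λ L⁺ → length L⁺ ≡ suc (length reps) × Represented T⁺ L⁺) → ⊥
      continue (L⁺ , grew , represented⁺) = fill T⁺ (larger (addEdge-larger T a closed a∉T)) record
        { closed      = addEdge-closed T a closed
        ; x0∉T        = x0∉addEdge T a a∉x0 x0∉T
        ; reps        = L⁺
        ; represented = represented⁺
        ; bound       = subst₂ (λ l c → (l + n) * 2 ≤ 4 + c) (sym grew) (sym (count-addEdge T a closed a∉T))
                               (s≤s (s≤s bound))
        }
    ... | no none = saturated T eb full
      where
      full : ∀ z → ¬ OnEdge x0 z → T z ≡ true
      full z z∉x0 with T z in Tz
      ... | true  = refl
      ... | false = ⊥-elim (none (z , Tz , z∉x0))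

    seed : GrowingTree (insert ∅ (vert x0)) ∅
    seed = record
      { closed = λ _ → refl
      ; x0∉T   = refl
      ; T⊆S    = λ _ ()
      ; root   = insert-here ∅ (vert x0)
      ; size   = trans (cong (2 +_) (count-∅ {2 * m}))
                       (cong (_* 2) (sym (trans (count-insert ∅ (vert x0) refl) (cong suc (count-∅ {n})))))
      ; covers = at-x0
      }
      where
      at-x0 : OrbitCovers ∅ x0 (insert ∅ (vert x0))
      at-x0 z z-at-x0 with insert-inv ∅ (vert x0) (vert z) z-at-x0
      ... | inj₁ eq = vert-orb x0 z (sym eq)

    impossible : ⊥
    impossible with grow-tree (insert ∅ (vert x0)) ∅ (LargerThan-wellFounded ∅) seed
    ... | T , eb = fill T (LargerThan-wellFounded T) eb

  edge-separates-faces : TwoConnected G → 2 ≤ m → ∀ x → face x ≢ face (α x)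
  edge-separates-faces tc m≥2 x same with second-edge m≥2 x
  ... | _ , y∉x = EdgeOnOneFace.impossible tc x y∉x same

  faceDeg-count : ∀ F → faceDeg G F ≡ count (λ v → does (incident? G v F))
  faceDeg-count F = length-filter-tabulate (λ v → incident? G v F) (λ v → v)

  faceDeg-≤-maxFaceDeg : ∀ F → faceDeg G F ≤ maxFaceDeg G
  faceDeg-≤-maxFaceDeg F = ≤-foldr-⊔ (∈-map⁺ (faceDeg G) (∈-allFin F))

  -- x and σ x lie at v, and face (σ x) is the face across the edge of x.
  vertex-on-two-faces : TwoConnected G → 2 ≤ m → ∀ v → 2 ≤ count (λ F → does (incident? G v F))
  vertex-on-two-faces tc m≥2 v with vert-surj v
  ... | x , x-at-v = count-≥2 (λ eq → edge-separates-faces tc m≥2 x (trans eq (face-σ x)))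
                              (dec-true (incident? G v _) (x , x-at-v , refl))
                              (dec-true (incident? G v _) (σ x , trans (vert-σ x) x-at-v , refl))

module _ {n m : ℕ} (G : PlaneGraph n m 3) (tc : TwoConnected G) where
  open PlaneGraph G

  three-faces⇒m≥2 : 2 ≤ m
  three-faces⇒m≥2 =
    subst (2 ≤_) (+-cancelʳ-≡ 2 (suc n) m (trans (sym (+-suc n 2)) euler)) (m≤n⇒m≤1+n (proj₁ tc))

  degree-sum : n * 2 ≤ faceDeg G zero + faceDeg G (suc zero) + faceDeg G (suc (suc zero))
  degree-sum rewrite faceDeg-count G zero | faceDeg-count G (suc zero) | faceDeg-count G (suc (suc zero)) =
    count-three-rows (λ F v → does (incident? G v F)) (vertex-on-two-faces G tc three-faces⇒m≥2)

  twice-order-≤ : n * 2 ≤ 3 * maxFaceDeg G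
  twice-order-≤ = begin
    n * 2          ≤⟨ degree-sum ⟩
    faceDeg G zero + faceDeg G (suc zero) + faceDeg G (suc (suc zero))
                   ≤⟨ +-mono-≤ (+-mono-≤ (≤M zero) (≤M (suc zero))) (≤M (suc (suc zero))) ⟩
    M + M + M      ≡⟨ triple M ⟩
    3 * M          ∎
    where
    open ≤-Reasoning
    M : ℕ
    M = maxFaceDeg G
    ≤M : ∀ F → faceDeg G F ≤ M
    ≤M = faceDeg-≤-maxFaceDeg G
    triple : ∀ k → k + k + k ≡ 3 * k
    triple = solve-∀

lemma1 : ∀ {n m : ℕ} (G : PlaneGraph n m 3) → TwoConnected G →
    ∃ λ (col : Fin n → Fin ((3 * maxFaceDeg G) / 2)) → Cyclic G col
lemma1 {n} G tc = (λ v → inject≤ v n≤colours) ,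
                  λ u v _ u≢v _ _ eq → u≢v (inject≤-injective _ _ u v eq)
  where
  open ≤-Reasoning
  n≤colours : n ≤ (3 * maxFaceDeg G) / 2
  n≤colours = begin
    n                       ≡⟨ sym (m*n/n≡m n 2) ⟩
    n * 2 / 2               ≤⟨ /-monoˡ-≤ 2 (twice-order-≤ G tc) ⟩
    3 * maxFaceDeg G / 2    ∎
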